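{- Let $n \ge 2$, let $p_n < p_{n+1}$ be consecutive primes, $g_n = p_{n+1}-p_n$, $m = (p_n+p_{n+1})/2$, and let $c_n$ be the number of odd multiples of $p_n$ in the interval $(p_np_{n+1}, m^2]$. Then $g_n < 2\sqrt{2p_n(c_n+1)}$.
   Context: $p_n$ denotes the $n$-th prime; for $n\ge2$ both $p_n,p_{n+1}$ are odd so $m$ is an integer and $p_np_{n+1}<m^2$. -}

module Defs where

open import Data.Nat using (ℕ; zero; suc; _+_; _*_; _∸_; _<_; _≤_; _/_)
open import Data.Nat.Primality using (Prime)
open import Data.Nat.Divisibility using (_∣_; _∣?_)
open import Data.Nat.Properties using (_<?_; _≤?_)
open import Data.List using (List; length; filter; upTo; map)
open import Data.Product using (_×_)
open import Relation.Nullary using (¬_)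
open import Relation.Nullary.Decidable using (_×-dec_; ¬?)
open import Relation.Unary using (Decidable)

ConsecutivePrimes : ℕ → ℕ → Set
ConsecutivePrimes p q = Prime p × Prime q × p < q × (∀ r → p < r → r < q → ¬ Prime r)

Odd : ℕ → Set
Odd j = ¬ (2 ∣ j)

interval : ℕ → ℕ → List ℕ
interval a b = map (λ i → suc a + i) (upTo (b ∸ a))

countOddMultiples : ℕ → ℕ → ℕ → ℕ
countOddMultiples p a b =
  length (filter (λ j → (p ∣? j) ×-dec (¬? (2 ∣? j))) (interval a b))

module Submission where

-- Both p and q are odd, so q = p + 2h with g = 2h, and
-- m = p + h, whence m² = pq + h².  The interval (pq, m²] therefore has length
-- h², and since pq is an odd multiple of p, the numbers pq + 2p, pq + 4p, …
-- are again odd multiples of p: every block of 2p consecutive numbers after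
-- pq contributes one of them.  Hence c ≥ ⌊h² / 2p⌋, i.e. h² < 2p(c + 1), and
-- multiplying by 4 gives g² < 4 · 2p(c + 1), the squared form of
-- g < 2√(2p(c + 1)).

open import Defs
open import Data.Nat using (ℕ; zero; suc; _+_; _*_; _∸_; _<_; _≤_; _/_; _%_; z≤n; s≤s; NonZero)
open import Data.Nat.Properties using (+-comm; +-suc; +-monoˡ-<; *-comm; *-suc; *-assoc; *-distribˡ-+; *-monoʳ-≤; *-monoʳ-<; *-cancelˡ-≤; m≤m+n; m+n∸m≡n; m+[n∸m]≡n; m≤n⇒m<n∨m≡n; ≤-pred; ≤-refl; ≤-trans; <⇒≤; module ≤-Reasoning)
open import Data.Nat.Divisibility using (_∣_; _∣?_; m%n≡0⇒n∣m; ∣m+n∣m⇒∣n; ∣m∣n⇒∣m+n; ∣-trans; n∣m*n; m∣m*n; 0∣⇒≡0; _∣0)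
open import Data.Nat.DivMod using (m≡m%n+[m/n]*n; m%n<n; m/n*n≤m; m*n/n≡m)
open import Data.Nat.Primality using (Prime; prime[2]; prime⇒irreducible; euclidsLemma)
open import Data.List using (List; []; _∷_; _∷ʳ_; _++_; length; filter; map; upTo)
open import Data.List.Properties using (length-++; filter-++; filter-accept; map-++; upTo-∷ʳ)
open import Data.Product using (_×_; _,_; ∃-syntax)
open import Data.Sum using (inj₁; inj₂)
open import Data.Empty using (⊥-elim)
open import Function using (_∘_)
open import Relation.Binary.PropositionalEquality using (_≡_; refl; sym; trans; cong; cong₂; subst; subst₂; module ≡-Reasoning)
open import Relation.Nullary using (¬_)
open import Relation.Nullary.Decidable using (_×-dec_; ¬?)
open import Relation.Unary using (Decidable)
open import Data.Nat.Solver using (module +-*-Solver)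
open +-*-Solver

-- The list a + 1, …, a + d of the d numbers following a, grown at the right
-- end so that the newest element a + d is directly accessible.
span : ℕ → ℕ → List ℕ
span a zero    = []
span a (suc d) = span a d ∷ʳ (a + suc d)

map-upTo≡span : ∀ a d → map (λ i → suc a + i) (upTo d) ≡ span a d
map-upTo≡span a zero    = refl
map-upTo≡span a (suc d) = begin
  map (suc a +_) (upTo (suc d))         ≡⟨ cong (map (suc a +_)) (sym (upTo-∷ʳ d)) ⟩
  map (suc a +_) (upTo d ∷ʳ d)          ≡⟨ map-++ (suc a +_) (upTo d) (d ∷ []) ⟩
  map (suc a +_) (upTo d) ∷ʳ (suc a + d) ≡⟨ cong₂ _∷ʳ_ (map-upTo≡span a d) (sym (+-suc a d)) ⟩
  span a d ∷ʳ (a + suc d)               ∎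
  where open ≡-Reasoning

interval≡span : ∀ a d → interval a (a + d) ≡ span a d
interval≡span a d =
  trans (cong (λ n → map (λ i → suc a + i) (upTo n)) (m+n∸m≡n a d)) (map-upTo≡span a d)

OddMultiple : ℕ → ℕ → Set
OddMultiple p j = p ∣ j × Odd j

oddMultiple? : ∀ p → Decidable (OddMultiple p)
oddMultiple? p j = (p ∣? j) ×-dec (¬? (2 ∣? j))

-- The number of odd multiples of p in a list, so that
-- countOddMultiples p a b is definitionally count p (interval a b).
count : ℕ → List ℕ → ℕ
count p xs = length (filter (oddMultiple? p) xs)

count-++ : ∀ p xs ys → count p (xs ++ ys) ≡ count p xs + count p ys
count-++ p xs ys =
  trans (cong length (filter-++ (oddMultiple? p) xs ys)) (length-++ (filter (oddMultiple? p) xs))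

count-∷ʳ-≤ : ∀ p xs x → count p xs ≤ count p (xs ∷ʳ x)
count-∷ʳ-≤ p xs x = subst (count p xs ≤_) (sym (count-++ p xs (x ∷ []))) (m≤m+n _ _)

count-∷ʳ-accept : ∀ p xs {x} → OddMultiple p x → count p (xs ∷ʳ x) ≡ suc (count p xs)
count-∷ʳ-accept p xs {x} x-ok = begin
  count p (xs ∷ʳ x)             ≡⟨ count-++ p xs (x ∷ []) ⟩
  count p xs + count p (x ∷ []) ≡⟨ cong (λ l → count p xs + length l) (filter-accept (oddMultiple? p) x-ok) ⟩
  count p xs + 1                ≡⟨ +-comm (count p xs) 1 ⟩
  suc (count p xs)              ∎
  where open ≡-Reasoning

count-span-mono : ∀ p a {d e} → d ≤ e → count p (span a d) ≤ count p (span a e)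
count-span-mono p a {e = zero}  z≤n  = ≤-refl
count-span-mono p a {d} {suc e} d≤1+e with m≤n⇒m<n∨m≡n d≤1+e
... | inj₁ d<1+e = ≤-trans (count-span-mono p a (≤-pred d<1+e)) (count-∷ʳ-≤ p (span a e) _)
... | inj₂ refl  = ≤-refl

odd-+-even : ∀ {a} → Odd a → ∀ k → Odd (a + 2 * k)
odd-+-even {a} a-odd k 2∣sum =
  a-odd (∣m+n∣m⇒∣n (subst (2 ∣_) (+-comm a (2 * k)) 2∣sum) (m∣m*n k))

oddMultiple-+ : ∀ {p a} → OddMultiple p a → ∀ k → OddMultiple p (a + 2 * p * k)
oddMultiple-+ {p} {a} (p∣a , a-odd) k =
  ∣m∣n⇒∣m+n p∣a (∣-trans (n∣m*n 2) (m∣m*n k)) ,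
  subst (Odd ∘ (a +_)) (sym (*-assoc 2 p k)) (odd-+-even a-odd (p * k))

-- The only multiple of 0 is 0, which is even.
no-oddMultiple-of-0 : ∀ {a} → ¬ OddMultiple 0 a
no-oddMultiple-of-0 (0∣a , a-odd) = a-odd (subst (2 ∣_) (sym (0∣⇒≡0 0∣a)) (2 ∣0))

-- If a is an odd multiple of p, the k-th block of 2p numbers after a ends in
-- the odd multiple a + 2pk of p, so J blocks contain at least J of them.
count-lower : ∀ {p a} → OddMultiple p a → ∀ J → J ≤ count p (span a (2 * p * J))
count-lower {zero} a-ok _ = ⊥-elim (no-oddMultiple-of-0 a-ok)
count-lower {p@(suc p′)} a-ok zero = z≤n
count-lower {p@(suc p′)} {a} a-ok (suc J) = begin
  suc J                                ≤⟨ s≤s (count-lower a-ok J) ⟩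
  suc (count p (span a (2 * p * J)))   ≤⟨ s≤s (count-span-mono p a (m≤m+n (2 * p * J) (p′ + p))) ⟩
  suc (count p (span a d))             ≡⟨ sym (count-∷ʳ-accept p (span a d) last-ok) ⟩
  count p (span a (suc d))             ≡⟨ cong (count p ∘ span a) block ⟩
  count p (span a (2 * p * suc J))     ∎
  where
  open ≤-Reasoning
  d = 2 * p * J + (p′ + p)
  block : suc d ≡ 2 * p * suc J
  block = solve 2 (λ p′ J → con 1 :+ (con 2 :* (con 1 :+ p′) :* J :+ (p′ :+ (con 1 :+ p′)))
                    := con 2 :* (con 1 :+ p′) :* (con 1 :+ J)) refl p′ J
  last-ok : OddMultiple p (a + suc d)
  last-ok = subst (OddMultiple p ∘ (a +_)) (sym block) (oddMultiple-+ a-ok (suc J))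

floor-bound : ∀ D .{{_ : NonZero D}} n c → n / D ≤ c → n < D * (c + 1)
floor-bound D n c n/D≤c = begin-strict
  n                       ≡⟨ m≡m%n+[m/n]*n n D ⟩
  n % D + n / D * D       <⟨ +-monoˡ-< (n / D * D) (m%n<n n D) ⟩
  D + n / D * D           ≡⟨ cong (D +_) (*-comm (n / D) D) ⟩
  D + D * (n / D)         ≡⟨ sym (*-suc D (n / D)) ⟩
  D * suc (n / D)         ≤⟨ *-monoʳ-≤ D (s≤s n/D≤c) ⟩
  D * suc c               ≡⟨ cong (D *_) (+-comm 1 c) ⟩
  D * (c + 1)             ∎
  where open ≤-Reasoning

count-bound : ∀ {p a} → OddMultiple p a → ∀ n → n < 2 * p * (count p (span a n) + 1)
count-bound {zero} a-ok _ = ⊥-elim (no-oddMultiple-of-0 a-ok)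
count-bound {p@(suc _)} {a} a-ok n = floor-bound (2 * p) n (count p (span a n)) (begin
  n / (2 * p)                              ≤⟨ count-lower a-ok (n / (2 * p)) ⟩
  count p (span a (2 * p * (n / (2 * p)))) ≤⟨ count-span-mono p a 2p⌊n/2p⌋≤n ⟩
  count p (span a n)                       ∎)
  where
  open ≤-Reasoning
  2p⌊n/2p⌋≤n : 2 * p * (n / (2 * p)) ≤ n
  2p⌊n/2p⌋≤n = subst (_≤ n) (*-comm (n / (2 * p)) (2 * p)) (m/n*n≤m n (2 * p))

-- A prime n ≥ 3 is odd: otherwise 2 would be a divisor different from 1 and n.
prime⇒odd : ∀ {n} → Prime n → 3 ≤ n → Odd n
prime⇒odd n-prime 3≤n 2∣n with prime⇒irreducible n-prime 2∣n
... | inj₁ ()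
... | inj₂ refl with 3≤n
...   | s≤s (s≤s ())

odd⇒1+2*half : ∀ n → Odd n → n ≡ suc (2 * (n / 2))
odd⇒1+2*half n n-odd with n % 2 in rem
... | 0           = ⊥-elim (n-odd (m%n≡0⇒n∣m n 2 rem))
... | 1           = trans (m≡m%n+[m/n]*n n 2) (trans (cong (_+ n / 2 * 2) rem) (cong suc (*-comm (n / 2) 2)))
... | suc (suc r) with subst (_< 2) rem (m%n<n n 2)
...   | s≤s (s≤s ())

odd-gap : ∀ {p q} → Odd p → Odd q → p ≤ q → ∃[ h ] q ≡ p + 2 * h
odd-gap {p} {q} p-odd q-odd p≤q = t ∸ s , (begin
  q                            ≡⟨ odd⇒1+2*half q q-odd ⟩
  suc (2 * t)                  ≡⟨ cong (suc ∘ (2 *_)) (sym (m+[n∸m]≡n s≤t)) ⟩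
  suc (2 * (s + (t ∸ s)))      ≡⟨ cong suc (*-distribˡ-+ 2 s (t ∸ s)) ⟩
  suc (2 * s) + 2 * (t ∸ s)    ≡⟨ cong (_+ 2 * (t ∸ s)) (sym (odd⇒1+2*half p p-odd)) ⟩
  p + 2 * (t ∸ s)              ∎)
  where
  open ≡-Reasoning
  s = p / 2
  t = q / 2
  s≤t : s ≤ t
  s≤t = *-cancelˡ-≤ 2 (≤-pred (subst₂ _≤_ (odd⇒1+2*half p p-odd) (odd⇒1+2*half q q-odd) p≤q))

odd-* : ∀ {p q} → Odd p → Odd q → Odd (p * q)
odd-* {p} {q} p-odd q-odd 2∣pq with euclidsLemma p q prime[2] 2∣pq
... | inj₁ 2∣p = p-odd 2∣p
... | inj₂ 2∣q = q-odd 2∣q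

-- The theorem for an odd p and q = p + 2h.  Then g = 2h, m = p + h and
-- m² = pq + h², so c counts the odd multiples of p in (pq, pq + h²] and
-- count-bound gives h² < 2p(c + 1).
half-gap-bound : ∀ p h → Odd p →
    let q = p + 2 * h
        g = q ∸ p
        m = (p + q) / 2
        c = countOddMultiples p (p * q) (m * m)
    in g * g < 4 * (2 * p * (c + 1))
half-gap-bound p h p-odd = begin-strict
  g * g                                              ≡⟨ cong₂ _*_ gap gap ⟩
  2 * h * (2 * h)                                    ≡⟨ solve 1 (λ h → con 2 :* h :* (con 2 :* h) := con 4 :* (h :* h)) refl h ⟩
  4 * (h * h)                                        <⟨ *-monoʳ-< 4 (count-bound pq-ok (h * h)) ⟩
  4 * (2 * p * (count p (span (p * q) (h * h)) + 1)) ≡⟨ cong (λ k → 4 * (2 * p * (k + 1))) (sym c≡count) ⟩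
  4 * (2 * p * (c + 1))                              ∎
  where
  open ≤-Reasoning
  q = p + 2 * h
  g = q ∸ p
  m = (p + q) / 2
  c = countOddMultiples p (p * q) (m * m)
  gap : g ≡ 2 * h
  gap = m+n∸m≡n p (2 * h)
  midpoint : m ≡ p + h
  midpoint = trans (cong (_/ 2) (solve 2 (λ p h → p :+ (p :+ con 2 :* h) := (p :+ h) :* con 2) refl p h))
                   (m*n/n≡m (p + h) 2)
  midpoint² : m * m ≡ p * q + h * h
  midpoint² = trans (cong₂ _*_ midpoint midpoint)
    (solve 2 (λ p h → (p :+ h) :* (p :+ h) := p :* (p :+ con 2 :* h) :+ h :* h) refl p h)
  c≡count : c ≡ count p (span (p * q) (h * h))
  c≡count = trans (cong (count p ∘ interval (p * q)) midpoint²) (cong (count p) (interval≡span (p * q) (h * h)))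
  pq-ok : OddMultiple p (p * q)
  pq-ok = m∣m*n q , odd-* p-odd (odd-+-even p-odd h)

-- Lemma 2.4: for consecutive primes 3 ≤ p < q with gap g, midpoint m and c odd
-- multiples of p in (pq, m²], g² < 4 · 2p(c + 1), i.e. g < 2√(2p(c + 1)).
lemma2p4 : ∀ (p q : ℕ) → ConsecutivePrimes p q → 3 ≤ p →
    let g = q ∸ p
        m = (p + q) / 2
        c = countOddMultiples p (p * q) (m * m)
    in g * g < 4 * (2 * p * (c + 1))
lemma2p4 p q (p-prime , q-prime , p<q , _) 3≤p
  with prime⇒odd p-prime 3≤p | prime⇒odd q-prime (≤-trans 3≤p (<⇒≤ p<q))
... | p-odd | q-odd with odd-gap p-odd q-odd (<⇒≤ p<q)
...   | h , refl = half-gap-bound p h p-odd
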